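{- Let $N\geq 1$ be an integer, $\rho\in(0,1)$, and $x\in\mathbb{Z}_{\geq 0}$. Let $d=\lceil\log_2(x+2)\rceil$, and let $p_d\#$ denote the product of the first $d$ primes. Then \[ \mathbf{E}[\#\Phi(\mathcal{D}_{\rho}(N))] \geq \left\lfloor \frac{N}{p_{d}\#} \right\rfloor \left(1 - \rho(2\rho-\rho^2)^{x} - (1-\rho)(1-\rho^2)^{x}\right). \]
   Context: The divisor graph $G_N$ is the simple graph with vertex set $\{1,\dots,N\}$ and an edge between distinct $a,b$ iff $a\mid b$ or $b\mid a$. The oriented divisor graph $D_N$ directs every edge $\{a,b\}$ with $b\mid a$, $a>b$ from $a$ to $b$. For $\rho\in[0,1]$, the randomly oriented divisor graph $\mathcal{D}_\rho(N)$ is obtained from $D_N$ by independently reversing the direction of each edge with probability $\rho$. A strongly connected component of a directed graph is a maximal subgraph in which there is a directed path between every pair of its vertices. $\#\Phi(\mathcal{D}_\rho(N))$ is the random variable giving the number of vertices of the largest strongly connected component of $\mathcal{D}_\rho(N)$, and $\mathbf{E}$ denotes expectation.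
   Formalization: The parameter ρ ranges over the rationals in the interval (0,1). -}

module Defs where

open import Data.Nat as ℕ using (ℕ; zero; suc; _≤_; _<_; NonZero)
open import Data.Nat.Divisibility using (_∣_; _∣?_)
open import Data.Nat.Primality using (Prime; prime?)
open import Data.Nat.Logarithm using (⌈log₂_⌉)
open import Data.Nat.DivMod using (_/_)
open import Data.Nat.ListAction using (product)
open import Data.Nat.Properties using (m*n≢0)
open import Data.Bool using (Bool; true; false)
open import Data.Fin using (Fin)
open import Data.List as List using (List; []; _∷_; length; filter; take; concatMap; upTo; map; foldr)
open import Data.List.Membership.Propositional using (_∈_)
open import Data.List.Relation.Unary.Unique.Propositional using (Unique)
open import Data.List.Relation.Unary.All as All using (All; []; _∷_)
open import Data.Vec as Vec using (Vec; []; _∷_)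
open import Data.Product using (Σ; _×_; _,_; ∃; proj₁; proj₂)
open import Data.Sum using (_⊎_)
open import Data.Integer using (+_)
open import Data.Rational as ℚ using (ℚ; 0ℚ; 1ℚ)
open import Relation.Binary.PropositionalEquality using (_≡_)
open import Relation.Binary.Construct.Closure.ReflexiveTransitive using (Star)
open import Relation.Nullary using (Dec; yes; no)

-- The oriented divisor graph D_N.
-- Edges are pairs (a , b) with 1 ≤ b < a ≤ N and b ∣ a; in D_N the
-- edge is directed from a to b.  We fix the enumeration order below.

edgesAt : ℕ → List (ℕ × ℕ)
edgesAt a = map (λ b → (a , b)) (filter (λ b → b ∣? a) (map suc (upTo (a ℕ.∸ 1))))

edges : ℕ → List (ℕ × ℕ)
edges N = concatMap edgesAt (map suc (upTo N))

numEdges : ℕ → ℕ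
numEdges N = length (edges N)

-- An outcome of the random reversal: for each edge (in the enumeration
-- order) a Bool saying whether that edge is reversed.
Orientation : ℕ → Set
Orientation N = Vec Bool (numEdges N)

Arc : (N : ℕ) → Orientation N → ℕ → ℕ → Set
Arc N o u v = Σ (Fin (numEdges N)) λ i →
  let e = List.lookup (edges N) i in
  (Vec.lookup o i ≡ false × u ≡ proj₁ e × v ≡ proj₂ e)
  ⊎ (Vec.lookup o i ≡ true × u ≡ proj₂ e × v ≡ proj₁ e)

Reach : (N : ℕ) → Orientation N → ℕ → ℕ → Set
Reach N o = Star (Arc N o)

SameSCC : (N : ℕ) → Orientation N → ℕ → ℕ → Set
SameSCC N o u v = Reach N o u v × Reach N o v u

EnumeratesSCC : (N : ℕ) → Orientation N → ℕ → List ℕ → Set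
EnumeratesSCC N o v xs = Unique xs × (∀ u → u ∈ xs → SameSCC N o u v)
                                   × (∀ u → SameSCC N o u v → u ∈ xs)

IsLargestSCCSize : (N : ℕ) → Orientation N → ℕ → Set
IsLargestSCCSize N o s =
  (Σ ℕ λ v → 1 ≤ v × v ≤ N × Σ (List ℕ) λ xs → EnumeratesSCC N o v xs × length xs ≡ s)
  × (∀ v → 1 ≤ v → v ≤ N → ∀ xs → EnumeratesSCC N o v xs → length xs ≤ s)

allVecs : (m : ℕ) → List (Vec Bool m)
allVecs zero = [] ∷ []
allVecs (suc m) = concatMap (λ v → (false ∷ v) ∷ (true ∷ v) ∷ []) (allVecs m)

weight : ℚ → ∀ {m} → Vec Bool m → ℚ
weight ρ [] = 1ℚ
weight ρ (false ∷ v) = (1ℚ ℚ.- ρ) ℚ.* weight ρ v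
weight ρ (true ∷ v) = ρ ℚ.* weight ρ v

ℕtoℚ : ℕ → ℚ
ℕtoℚ n = (+ n) ℚ./ 1

expectation : (N : ℕ) → ℚ → (Orientation N → ℕ) → ℚ
expectation N ρ X =
  foldr ℚ._+_ 0ℚ (map (λ o → weight ρ o ℚ.* ℕtoℚ (X o)) (allVecs (numEdges N)))

_^ℚ_ : ℚ → ℕ → ℚ
q ^ℚ zero = 1ℚ
q ^ℚ suc n = q ℚ.* (q ^ℚ n)

-- the first d primes: the d-th prime is at most 2 ^ (2 ^ d)
-- (Euclid's bound), so they all occur among 0 .. 2 ^ (2 ^ d)
firstPrimes : ℕ → List ℕ
firstPrimes d = take d (filter prime? (upTo (suc (2 ℕ.^ (2 ℕ.^ d)))))

primorial : ℕ → ℕ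
primorial d = product (firstPrimes d)

private
  take-All : ∀ {P : ℕ → Set} n (xs : List ℕ) → All P xs → All P (take n xs)
  take-All zero xs ps = []
  take-All (suc n) [] ps = []
  take-All (suc n) (x ∷ xs) (p ∷ ps) = p ∷ take-All n xs ps

  filter-All : (xs : List ℕ) → All Prime (filter prime? xs)
  filter-All [] = []
  filter-All (x ∷ xs) with prime? x
  ... | yes p = p ∷ filter-All xs
  ... | no _ = filter-All xs

  prime-nz : ∀ {p} → Prime p → NonZero p
  prime-nz {suc p} _ = _

  prod-nz : (xs : List ℕ) → All Prime xs → NonZero (product xs)
  prod-nz [] _ = _
  prod-nz (x ∷ xs) (p ∷ ps) =
    m*n≢0 x (product xs) {{prime-nz p}} {{prod-nz xs ps}}

primorial-nonZero : ∀ d → NonZero (primorial d)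
primorial-nonZero d = prod-nz (firstPrimes d)
  (take-All d _ (filter-All (upTo (suc (2 ℕ.^ (2 ℕ.^ d))))))

floorDivPrimorial : ℕ → ℕ → ℕ
floorDivPrimorial N d = (N / primorial d) {{primorial-nonZero d}}

dOf : ℕ → ℕ
dOf x = ⌈log₂ (x ℕ.+ 2) ⌉

{-# OPTIONS --safe #-}
-- Let P = p_d#. Distinct Fermat numbers have distinct prime factors, so the first d primes are at
-- most 2 ^ 2 ^ d, and P has 2 ^ d ≥ x + 2 squarefree divisors, hence x divisors b with 1 < b < P.
-- Each multiple a = kP ≤ N is joined to 1 by the edge a — 1 and by x detours a — b — 1, using
-- 2x + 1 distinct, hence independently oriented, edges. If a — 1 keeps its direction a → 1
-- (probability 1 − ρ), a and 1 are strongly connected once some detour has both edges reversed,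
-- which fails with probability (1 − ρ²)^x; if it is reversed (probability ρ), some detour must keep
-- both edges, which fails with probability (1 − (1 − ρ)²)^x = (2ρ − ρ²)^x. The multiples linked to 1
-- lie in one strongly connected component, and linearity of expectation gives the bound.
module Submission where

open import Defs
open import Data.Nat using (ℕ)
open import Data.Rational using (ℚ)

module Counting where

  open import Data.Nat using (ℕ; zero; suc; _≤_; _<_; z≤n; s≤s)
  open import Data.Nat.Properties using (≤-trans; ≤-reflexive; +-suc; ≤-pred; m≤n⇒m<n∨m≡n; _<?_)
  open import Data.List using (List; []; _∷_; length; _++_; filter; upTo)
  open import Data.List.Properties using (length-++)
  open import Data.List.Membership.Propositional using (_∈_)
  open import Data.List.Membership.Propositional.Properties
    using (∈-∃++; ∈-++⁻; ∈-++⁺ˡ; ∈-++⁺ʳ; ∈-filter⁺; ∈-filter⁻; ∈-upTo⁺)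
  open import Data.List.Relation.Unary.Any using (here; there)
  open import Data.List.Relation.Unary.All using () renaming (lookup to All-lookup)
  open import Data.List.Relation.Unary.AllPairs using (_∷_)
  open import Data.List.Relation.Unary.Unique.Propositional using (Unique)
  import Data.List.Relation.Unary.Unique.Propositional.Properties as Unique
  open import Data.Product using (∃; _×_; _,_; proj₂)
  open import Data.Sum using (inj₁; inj₂; [_,_]′)
  open import Data.Empty using (⊥-elim)
  open import Function using (_∘_)
  open import Relation.Binary.PropositionalEquality using (_≡_; refl; sym; trans; cong)
  open import Relation.Nullary using (¬_; Dec; yes; no; contradiction; ¬¬-map)
  open import Relation.Nullary.Decidable using (¬¬-excluded-middle)
  open import Relation.Unary using (Decidable)

  Unique-⊆⇒length≤ : ∀ {A : Set} {xs : List A} (ys : List A) →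
                      Unique ys → (∀ {y} → y ∈ ys → y ∈ xs) → length ys ≤ length xs
  Unique-⊆⇒length≤ [] _ _ = z≤n
  Unique-⊆⇒length≤ (y ∷ ys) (y∉ys ∷ uniq) ys⊆xs with ∈-∃++ (ys⊆xs (here refl))
  ... | pre , post , refl =
    ≤-trans (s≤s (Unique-⊆⇒length≤ ys uniq ys⊆pre++post)) (≤-reflexive (sym length-xs))
    where
    length-xs : length (pre ++ y ∷ post) ≡ suc (length (pre ++ post))
    length-xs = trans (length-++ pre) (trans (+-suc (length pre) (length post)) (cong suc (sym (length-++ pre))))
    ys⊆pre++post : ∀ {z} → z ∈ ys → z ∈ pre ++ post
    ys⊆pre++post z∈ys with ∈-++⁻ pre (ys⊆xs (there z∈ys))
    ... | inj₁ z∈pre          = ∈-++⁺ˡ z∈pre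
    ... | inj₂ (here refl)    = ⊥-elim (All-lookup y∉ys z∈ys refl)
    ... | inj₂ (there z∈post) = ∈-++⁺ʳ pre z∈post

  -- Membership in Q need not be decidable, but under a double negation it is, and that suffices to list Q.
  ¬¬-enumerate : ∀ {Q : ℕ → Set} n → (∀ {u} → Q u → u < n) →
                 ¬ ¬ (∃ λ xs → Unique xs × (∀ u → u ∈ xs → Q u) × (∀ u → Q u → u ∈ xs))
  ¬¬-enumerate {Q} n Q<n = ¬¬-map enumerate (¬¬-decidableBelow n)
    where
    ¬¬-decidableBelow : ∀ n → ¬ ¬ (∀ u → u < n → Dec (Q u))
    ¬¬-decidableBelow zero    = contradiction (λ _ ())
    ¬¬-decidableBelow (suc n) ¬dec = ¬¬-decidableBelow n λ decBelow → ¬¬-excluded-middle λ dec-n →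
      ¬dec λ u u<1+n → [ decBelow u , (λ { refl → dec-n }) ]′ (m≤n⇒m<n∨m≡n (≤-pred u<1+n))
    enumerate : (∀ u → u < n → Dec (Q u)) →
                ∃ λ xs → Unique xs × (∀ u → u ∈ xs → Q u) × (∀ u → Q u → u ∈ xs)
    enumerate decBelow =
      filter Q? (upTo n) ,
      Unique.filter⁺ Q? (Unique.upTo⁺ n) ,
      (λ u u∈ → proj₂ (∈-filter⁻ Q? {xs = upTo n} u∈)) ,
      (λ u q → ∈-filter⁺ Q? (∈-upTo⁺ (Q<n q)) q)
      where
      Q? : Decidable Q
      Q? u with u <? n
      ... | yes u<n = decBelow u u<n
      ... | no  u≮n = no (u≮n ∘ Q<n)

module Primes where

  open Counting
  open import Data.Nat as ℕ using (ℕ; zero; suc; _≤_; _<_; _>_; z≤n; s≤s; _+_; _*_; _^_; ⌈_/2⌉; NonZero)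
  open import Data.Nat.Properties
  open import Data.Nat.Divisibility
  open import Data.Nat.Primality using (Prime; prime?; prime⇒nonZero; prime⇒nonTrivial; productOfPrimes≢0)
  open import Data.Nat.Primality.Factorisation using (factorise; factorisationHasAllPrimeFactors)
  open import Data.Nat.Logarithm.Core using (⌈log2⌉)
  open import Data.Nat.ListAction using (product)
  open import Data.Nat.Tactic.RingSolver using (solve-∀)
  open import Data.List using (List; []; _∷_; length; _++_; map; filter; take; upTo)
  open import Data.List.Properties using (length-++; length-map; length-take; length-upTo)
  open import Data.List.Membership.Propositional using (_∈_)
  open import Data.List.Membership.Propositional.Properties
    using (∈-map⁻; ∈-filter⁺; ∈-filter⁻; ∈-upTo⁺; ∈-upTo⁻)
  open import Data.List.Relation.Unary.Any using (here; there)
  open import Data.List.Relation.Unary.All as All using (All; []; _∷_)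
  import Data.List.Relation.Unary.All.Properties as All
  open import Data.List.Relation.Unary.AllPairs using ([]; _∷_)
  open import Data.List.Relation.Unary.Unique.Propositional using (Unique)
  import Data.List.Relation.Unary.Unique.Propositional.Properties as Unique
  open import Data.Product using (∃; _×_; _,_; proj₁; proj₂)
  open import Data.Sum using (inj₁; inj₂)
  open import Data.Empty using (⊥-elim)
  open import Induction.WellFounded using (Acc; acc)
  open import Relation.Binary.Definitions using (tri<; tri≈; tri>)
  open import Relation.Binary.PropositionalEquality
  open import Relation.Nullary using (¬_; Dec; yes; no; ¬?; _×-dec_)

  n≤2^⌈log2⌉n : ∀ n (rec : Acc _<_ n) → n ≤ 2 ^ ⌈log2⌉ n rec
  n≤2^⌈log2⌉n zero          _        = z≤n
  n≤2^⌈log2⌉n (suc zero)    _        = s≤s z≤n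
  n≤2^⌈log2⌉n (suc (suc n)) (acc rs) = begin
    2 + n                            ≤⟨ +-monoʳ-≤ 2 n≤⌈n/2⌉+⌈n/2⌉ ⟩
    2 + (⌈ n /2⌉ + ⌈ n /2⌉)          ≡⟨ double-suc ⌈ n /2⌉ ⟩
    2 * suc ⌈ n /2⌉                  ≤⟨ *-monoʳ-≤ 2 (n≤2^⌈log2⌉n (suc ⌈ n /2⌉) _) ⟩
    2 * 2 ^ ⌈log2⌉ (suc ⌈ n /2⌉) _   ∎
    where
    open ≤-Reasoning
    n≤⌈n/2⌉+⌈n/2⌉ : n ≤ ⌈ n /2⌉ + ⌈ n /2⌉
    n≤⌈n/2⌉+⌈n/2⌉ = subst (_≤ ⌈ n /2⌉ + ⌈ n /2⌉) (⌊n/2⌋+⌈n/2⌉≡n n)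
                          (+-monoˡ-≤ ⌈ n /2⌉ (⌊n/2⌋≤⌈n/2⌉ n))
    double-suc : ∀ c → 2 + (c + c) ≡ 2 * suc c
    double-suc = solve-∀

  x+2≤2^dOf : ∀ x → x + 2 ≤ 2 ^ dOf x
  x+2≤2^dOf x = n≤2^⌈log2⌉n (x + 2) _

  fermat : ℕ → ℕ
  fermat i = 1 + 2 ^ 2 ^ i

  fermatProduct : ℕ → ℕ
  fermatProduct zero    = 1
  fermatProduct (suc n) = fermatProduct n * fermat n

  1+fermatProduct≡2^2^n : ∀ n → 1 + fermatProduct n ≡ 2 ^ 2 ^ n
  1+fermatProduct≡2^2^n zero    = refl
  1+fermatProduct≡2^2^n (suc n) = begin
    1 + P * (1 + 2 ^ 2 ^ n)   ≡⟨ cong (λ t → 1 + P * (1 + t)) (sym IH) ⟩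
    1 + P * (1 + (1 + P))     ≡⟨ square-suc P ⟩
    (1 + P) * (1 + P)         ≡⟨ cong₂ _*_ IH IH ⟩
    2 ^ 2 ^ n * 2 ^ 2 ^ n     ≡⟨ ^-distribˡ-+-* 2 (2 ^ n) (2 ^ n) ⟨
    2 ^ (2 ^ n + 2 ^ n)       ≡⟨ cong (2 ^_) (cong (2 ^ n +_) (+-identityʳ (2 ^ n))) ⟨
    2 ^ 2 ^ suc n             ∎
    where
    open ≡-Reasoning
    P : ℕ
    P = fermatProduct n
    IH : 1 + P ≡ 2 ^ 2 ^ n
    IH = 1+fermatProduct≡2^2^n n
    square-suc : ∀ p → 1 + p * (1 + (1 + p)) ≡ (1 + p) * (1 + p)
    square-suc = solve-∀

  fermat-∣-fermatProduct : ∀ {i j} → i < j → fermat i ∣ fermatProduct j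
  fermat-∣-fermatProduct {i} {suc j} (s≤s i≤j) with m≤n⇒m<n∨m≡n i≤j
  ... | inj₁ i<j  = ∣m⇒∣m*n (fermat j) (fermat-∣-fermatProduct i<j)
  ... | inj₂ refl = n∣m*n (fermatProduct i)

  fermat-odd : ∀ i → ¬ 2 ∣ fermat i
  fermat-odd i 2∣F with 2 ^ i | m^n>0 2 i
  ... | suc k | _ with ∣1⇒≡1 (∣m+n∣m⇒∣n (subst (2 ∣_) (+-comm 1 (2 * 2 ^ k)) 2∣F) (m∣m*n (2 ^ k)))
  ...   | ()

  -- F_j − 2 is a multiple of F_i for i < j, so a common prime factor divides 2; but F_i is odd.
  fermat-coprime : ∀ {q i j} → Prime q → q ∣ fermat i → q ∣ fermat j → ¬ i < j
  fermat-coprime {q} {i} {j} q-prime q∣Fi q∣Fj i<j = fermat-odd i (subst (_∣ fermat i) q≡2 q∣Fi)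
    where
    Fj≡ : fermat j ≡ fermatProduct j + 2
    Fj≡ = trans (cong suc (sym (1+fermatProduct≡2^2^n j))) (+-comm 2 (fermatProduct j))
    q∣2 : q ∣ 2
    q∣2 = ∣m+n∣m⇒∣n (subst (q ∣_) Fj≡ q∣Fj) (∣-trans q∣Fi (fermat-∣-fermatProduct i<j))
    q≡2 : q ≡ 2
    q≡2 = ≤-antisym (∣⇒≤ q∣2) (ℕ.nonTrivial⇒n>1 q {{prime⇒nonTrivial q-prime}})

  fermat-commonPrime⇒≡ : ∀ {q i j} → Prime q → q ∣ fermat i → q ∣ fermat j → i ≡ j
  fermat-commonPrime⇒≡ {i = i} {j} q-prime q∣Fi q∣Fj with <-cmp i j
  ... | tri< i<j _ _ = ⊥-elim (fermat-coprime q-prime q∣Fi q∣Fj i<j)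
  ... | tri≈ _ i≡j _ = i≡j
  ... | tri> _ _ j<i = ⊥-elim (fermat-coprime q-prime q∣Fj q∣Fi j<i)

  primeFactor : ∀ n → 1 < n → ∃ λ q → Prime q × q ∣ n
  primeFactor n@(suc _) 1<n with factorise n
  ... | record { factors = [] ; isFactorisation = n≡1 } = ⊥-elim (<-irrefl (sym n≡1) 1<n)
  ... | record { factors = q ∷ qs ; isFactorisation = n≡q*qs ; factorsPrime = q-prime ∷ _ } =
    q , q-prime , subst (q ∣_) (sym n≡q*qs) (m∣m*n (product qs))

  fermat>1 : ∀ i → fermat i > 1
  fermat>1 i = s≤s (m^n>0 2 (2 ^ i))

  fermatPrime : ℕ → ℕ
  fermatPrime i = proj₁ (primeFactor (fermat i) (fermat>1 i))

  fermatPrime-prime : ∀ i → Prime (fermatPrime i)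
  fermatPrime-prime i = proj₁ (proj₂ (primeFactor (fermat i) (fermat>1 i)))

  fermatPrime-∣ : ∀ i → fermatPrime i ∣ fermat i
  fermatPrime-∣ i = proj₂ (proj₂ (primeFactor (fermat i) (fermat>1 i)))

  fermatPrime-injective : ∀ {i j} → fermatPrime i ≡ fermatPrime j → i ≡ j
  fermatPrime-injective {i} {j} eq =
    fermat-commonPrime⇒≡ (fermatPrime-prime i) (fermatPrime-∣ i) (subst (_∣ fermat j) (sym eq) (fermatPrime-∣ j))

  1+2^k≤2^1+k : ∀ k → 1 + 2 ^ k ≤ 2 ^ suc k
  1+2^k≤2^1+k k = subst (1 + 2 ^ k ≤_) (cong (2 ^ k +_) (sym (+-identityʳ (2 ^ k))))
                    (+-monoˡ-≤ (2 ^ k) (m^n>0 2 k))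

  fermat≤2^2^d : ∀ {i d} → i < d → fermat i ≤ 2 ^ 2 ^ d
  fermat≤2^2^d {i} i<d =
    ≤-trans (1+2^k≤2^1+k (2 ^ i)) (^-monoʳ-≤ 2 (≤-trans (1+2^k≤2^1+k i) (^-monoʳ-≤ 2 i<d)))

  primesUpTo : ℕ → List ℕ
  primesUpTo n = filter prime? (upTo (suc n))

  d≤#primesUpTo2^2^d : ∀ d → d ≤ length (primesUpTo (2 ^ 2 ^ d))
  d≤#primesUpTo2^2^d d =
    subst (_≤ length (primesUpTo (2 ^ 2 ^ d))) (trans (length-map fermatPrime (upTo d)) (length-upTo d))
      (Unique-⊆⇒length≤ (map fermatPrime (upTo d))
        (Unique.map⁺ fermatPrime-injective (Unique.upTo⁺ d)) fermatPrimes⊆primes)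
    where
    fermatPrimes⊆primes : ∀ {q} → q ∈ map fermatPrime (upTo d) → q ∈ primesUpTo (2 ^ 2 ^ d)
    fermatPrimes⊆primes q∈ with ∈-map⁻ fermatPrime q∈
    ... | i , i<d , refl = ∈-filter⁺ prime?
      (∈-upTo⁺ (s≤s (≤-trans (∣⇒≤ (fermatPrime-∣ i)) (fermat≤2^2^d (∈-upTo⁻ i<d)))))
      (fermatPrime-prime i)

  length-firstPrimes : ∀ d → length (firstPrimes d) ≡ d
  length-firstPrimes d = trans (length-take d _) (m≤n⇒m⊓n≡m (d≤#primesUpTo2^2^d d))

  firstPrimes-unique : ∀ d → Unique (firstPrimes d)
  firstPrimes-unique d = Unique.take⁺ d (Unique.filter⁺ prime? (Unique.upTo⁺ (suc (2 ^ 2 ^ d))))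

  firstPrimes-prime : ∀ d → All Prime (firstPrimes d)
  firstPrimes-prime d = All.take⁺ d (All.all-filter prime? (upTo (suc (2 ^ 2 ^ d))))

  product≥2 : ∀ {ps} → All Prime ps → 1 ≤ length ps → 2 ≤ product ps
  product≥2 {p ∷ ps} (p-prime ∷ ps-prime) _ =
    ≤-trans (ℕ.nonTrivial⇒n>1 p {{prime⇒nonTrivial p-prime}})
            (m≤m*n p (product ps) {{productOfPrimes≢0 ps-prime}})

  primorial-dOf≥2 : ∀ x → 2 ≤ primorial (dOf x)
  primorial-dOf≥2 x = product≥2 (firstPrimes-prime d) (subst (1 ≤_) (sym (length-firstPrimes d)) 1≤d)
    where
    d : ℕ
    d = dOf x
    1≤d : 1 ≤ d
    1≤d with d | x+2≤2^dOf x
    ... | zero  | x+2≤1 = ⊥-elim (<-irrefl refl (≤-trans (m≤n+m 2 x) x+2≤1))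
    ... | suc _ | _     = s≤s z≤n

  subsetProducts : List ℕ → List ℕ
  subsetProducts []       = 1 ∷ []
  subsetProducts (p ∷ ps) = subsetProducts ps ++ map (p *_) (subsetProducts ps)

  length-subsetProducts : ∀ ps → length (subsetProducts ps) ≡ 2 ^ length ps
  length-subsetProducts []       = refl
  length-subsetProducts (p ∷ ps) = begin
    length (subsetProducts ps ++ map (p *_) (subsetProducts ps)) ≡⟨ length-++ (subsetProducts ps) ⟩
    length (subsetProducts ps) + length (map (p *_) (subsetProducts ps))
                                  ≡⟨ cong (length (subsetProducts ps) +_) (length-map (p *_) (subsetProducts ps)) ⟩
    length (subsetProducts ps) + length (subsetProducts ps)
                                  ≡⟨ cong (λ n → n + n) (length-subsetProducts ps) ⟩
    2 ^ length ps + 2 ^ length ps ≡⟨ cong (2 ^ length ps +_) (+-identityʳ (2 ^ length ps)) ⟨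
    2 ^ length (p ∷ ps)           ∎
    where open ≡-Reasoning

  subsetProducts-∣ : ∀ ps → All (_∣ product ps) (subsetProducts ps)
  subsetProducts-∣ []       = ∣-refl ∷ []
  subsetProducts-∣ (p ∷ ps) = All.++⁺ (All.map (∣n⇒∣m*n p) (subsetProducts-∣ ps))
                                      (All.map⁺ (All.map (*-monoʳ-∣ p) (subsetProducts-∣ ps)))

  -- A product p * e with e ∣ product ps would make the prime p a factor of product ps.
  subsetProducts-unique : ∀ {ps} → Unique ps → All Prime ps → Unique (subsetProducts ps)
  subsetProducts-unique {[]}     _                  _                   = [] ∷ []
  subsetProducts-unique {p ∷ ps} (p∉ps ∷ ps-unique) (p-prime ∷ ps-prime) =
    Unique.++⁺ IH (Unique.map⁺ (*-cancelˡ-≡ _ _ p {{prime⇒nonZero p-prime}}) IH) disjoint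
    where
    IH : Unique (subsetProducts ps)
    IH = subsetProducts-unique ps-unique ps-prime
    disjoint : ∀ {v} → ¬ (v ∈ subsetProducts ps × v ∈ map (p *_) (subsetProducts ps))
    disjoint (v∈ , pe∈) with ∈-map⁻ (p *_) pe∈
    ... | e , _ , refl = All.lookup p∉ps
      (factorisationHasAllPrimeFactors p-prime (∣-trans (m∣m*n e) (All.lookup (subsetProducts-∣ ps) v∈)) ps-prime)
      refl

  ∣n∧≢1⇒>1 : ∀ {b n} .{{_ : NonZero n}} → b ∣ n → b ≢ 1 → b > 1
  ∣n∧≢1⇒>1 {zero}        {n} 0∣n _   = ⊥-elim (ℕ.≢-nonZero⁻¹ n (0∣⇒≡0 0∣n))
  ∣n∧≢1⇒>1 {suc zero}    _   1≢1 = ⊥-elim (1≢1 refl)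
  ∣n∧≢1⇒>1 {suc (suc _)} _   _   = s≤s (s≤s z≤n)

  NontrivialDivisorOf : ℕ → ℕ → Set
  NontrivialDivisorOf n b = 1 < b × b < n × b ∣ n

  nontrivialDivisors : ∀ {n} .{{_ : NonZero n}} x (ds : List ℕ) → Unique ds → All (_∣ n) ds →
    x + 2 ≤ length ds → ∃ λ bs → length bs ≡ x × Unique bs × All (NontrivialDivisorOf n) bs
  nontrivialDivisors {n} x ds ds-unique ds∣n x+2≤|ds| =
    take x inner ,
    trans (length-take x inner) (m≤n⇒m⊓n≡m x≤|inner|) ,
    Unique.take⁺ x (Unique.filter⁺ nontrivial? ds-unique) ,
    All.take⁺ x (All.tabulate (λ b∈ → nontrivial (∈-filter⁻ nontrivial? b∈)))
    where
    nontrivial? : ∀ b → Dec (b ≢ 1 × b ≢ n)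
    nontrivial? b = ¬? (b ℕ.≟ 1) ×-dec ¬? (b ℕ.≟ n)
    inner : List ℕ
    inner = filter nontrivial? ds
    ds⊆1∷n∷inner : ∀ {b} → b ∈ ds → b ∈ 1 ∷ n ∷ inner
    ds⊆1∷n∷inner {b} b∈ds with b ℕ.≟ 1 | b ℕ.≟ n
    ... | yes refl | _        = here refl
    ... | no _     | yes refl = there (here refl)
    ... | no b≢1   | no b≢n   = there (there (∈-filter⁺ nontrivial? b∈ds (b≢1 , b≢n)))
    x≤|inner| : x ≤ length inner
    x≤|inner| = +-cancelʳ-≤ 2 x (length inner)
      (≤-trans x+2≤|ds| (subst (length ds ≤_) (+-comm 2 (length inner))
                          (Unique-⊆⇒length≤ ds ds-unique ds⊆1∷n∷inner)))
    nontrivial : ∀ {b} → b ∈ ds × (b ≢ 1 × b ≢ n) → NontrivialDivisorOf n b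
    nontrivial (b∈ds , b≢1 , b≢n) = ∣n∧≢1⇒>1 b∣n b≢1 , ≤∧≢⇒< (∣⇒≤ b∣n) b≢n , b∣n
      where b∣n = All.lookup ds∣n b∈ds

  primorial-nontrivialDivisors : ∀ x →
    ∃ λ bs → length bs ≡ x × Unique bs × All (NontrivialDivisorOf (primorial (dOf x))) bs
  primorial-nontrivialDivisors x =
    nontrivialDivisors {{primorial-nonZero d}} x (subsetProducts (firstPrimes d))
      (subsetProducts-unique (firstPrimes-unique d) (firstPrimes-prime d))
      (subsetProducts-∣ (firstPrimes d))
      (subst (x + 2 ≤_) (sym |subsetProducts|≡2^d) (x+2≤2^dOf x))
    where
    d : ℕ
    d = dOf x
    |subsetProducts|≡2^d : length (subsetProducts (firstPrimes d)) ≡ 2 ^ d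
    |subsetProducts|≡2^d = trans (length-subsetProducts (firstPrimes d)) (cong (2 ^_) (length-firstPrimes d))

module NatToRational where

  open import Data.Nat as ℕ using (ℕ)
  open import Data.Integer as ℤ using (+_)
  import Data.Integer.Properties as ℤ
  open import Data.Nat.Coprimality using (1-coprimeTo; sym)
  open import Data.Rational as ℚ using (ℚ; mkℚ; 1ℚ; _+_)
  import Data.Rational.Properties as ℚ
  open import Relation.Binary.PropositionalEquality using (_≡_; cong; subst₂) renaming (sym to ≡-sym)

  ℕtoℚ≡mkℚ : ∀ n → ℕtoℚ n ≡ mkℚ (+ n) 0 (sym (1-coprimeTo n))
  ℕtoℚ≡mkℚ n = ℚ.normalize-coprime (sym (1-coprimeTo n))

  ℕtoℚ-suc : ∀ n → ℕtoℚ (ℕ.suc n) ≡ 1ℚ + ℕtoℚ n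
  ℕtoℚ-suc n rewrite ℕtoℚ≡mkℚ n = ≡-sym (cong (λ m → (+ 1 ℤ.+ m) ℚ./ 1) (ℤ.*-identityʳ (+ n)))

  ℕtoℚ-mono-≤ : ∀ {m n} → m ℕ.≤ n → ℕtoℚ m ℚ.≤ ℕtoℚ n
  ℕtoℚ-mono-≤ {m} {n} m≤n rewrite ℕtoℚ≡mkℚ m | ℕtoℚ≡mkℚ n =
    ℚ.*≤* (subst₂ ℤ._≤_ (≡-sym (ℤ.*-identityʳ (+ m))) (≡-sym (ℤ.*-identityʳ (+ n))) (ℤ.+≤+ m≤n))

module Coins where

  open import Level using (0ℓ)
  open import Data.Nat using (suc)
  open import Data.Rational using (0ℚ; 1ℚ)
  open import Data.Bool using (Bool; true; false; not; _∧_; _∨_; if_then_else_)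
  open import Data.Fin as Fin using (Fin)
  open import Data.Vec using (Vec; _∷_; lookup)
  open import Data.List using (List; []; _∷_; concatMap)
  open import Data.Bool.ListAction using (any)
  open import Data.List.Membership.Propositional using (_∈_)
  open import Data.List.Relation.Unary.Any using (here; there)
  open import Data.Product using (_×_; _,_)
  open import Function using (_∘_)
  open import Relation.Binary.PropositionalEquality using (_≡_; refl; cong; cong₂)
  open import Relation.Nullary using (¬_; contradiction)
  open import Relation.Unary using (Pred; _⊢_)

  χ : Bool → ℚ
  χ true  = 1ℚ
  χ false = 0ℚ

  DependsOn : ∀ {m} {A : Set} → Pred (Fin m) 0ℓ → (Vec Bool m → A) → Set
  DependsOn P f = ∀ o o' → (∀ {i} → P i → lookup o i ≡ lookup o' i) → f o ≡ f o'

  dependsOn-∷ : ∀ {m A P} {f : Vec Bool (suc m) → A} b →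
                DependsOn P f → DependsOn (Fin.suc ⊢ P) (λ o → f (b ∷ o))
  dependsOn-∷ b f-dep o o' agree =
    f-dep (b ∷ o) (b ∷ o') λ { {Fin.zero} _ → refl ; {Fin.suc i} p → agree p }

  dependsOn-∉ : ∀ {m A P} {f : Vec Bool (suc m) → A} →
                DependsOn P f → ¬ P Fin.zero → ∀ o → f (false ∷ o) ≡ f (true ∷ o)
  dependsOn-∉ f-dep 0∉P o =
    f-dep (false ∷ o) (true ∷ o) λ { {Fin.zero} p → contradiction p 0∉P ; {Fin.suc i} _ → refl }

  dependsOn-map : ∀ {m A B P} {f : Vec Bool m → A} (h : A → B) → DependsOn P f → DependsOn P (λ o → h (f o))
  dependsOn-map h f-dep o o' agree = cong h (f-dep o o' agree)

  literal : Bool → Bool → Bool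
  literal true  v = v
  literal false v = not v

  endpoints : ∀ {A : Set} → List (A × A) → List A
  endpoints = concatMap (λ (j , k) → j ∷ k ∷ [])

  somePairBoth : ∀ {m} → Bool → List (Fin m × Fin m) → Vec Bool m → Bool
  somePairBoth b ps o = any (λ (j , k) → literal b (lookup o j) ∧ literal b (lookup o k)) ps

  somePairBoth-dependsOn : ∀ {m} b (ps : List (Fin m × Fin m)) → DependsOn (_∈ endpoints ps) (somePairBoth b ps)
  somePairBoth-dependsOn b []            o o' agree = refl
  somePairBoth-dependsOn b ((j , k) ∷ ps) o o' agree =
    cong₂ _∨_ (cong₂ _∧_ (cong (literal b) (agree (here refl))) (cong (literal b) (agree (there (here refl)))))
              (somePairBoth-dependsOn b ps o o' (agree ∘ there ∘ there))

  -- Coin i orients the edge a — 1; the pairs orient detours a — b — 1, which must then run the other way.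
  linked : ∀ {m} → Fin m → List (Fin m × Fin m) → Vec Bool m → Bool
  linked i ps o = if lookup o i then somePairBoth false ps o else somePairBoth true ps o

module Bernoulli (ρ : ℚ) where

  open NatToRational
  open Coins
  open import Level using (0ℓ)
  open import Data.Nat using (ℕ; zero; suc)
  open import Data.Rational as ℚ using (0ℚ; 1ℚ; _+_; _*_; _-_; _≤_; NonNegative)
  import Data.Rational.Properties as ℚ
  open import Data.Rational.Solver using (module +-*-Solver)
  open import Data.Bool using (Bool; true; false; not; _∧_; _∨_; if_then_else_)
  open import Data.Fin as Fin using (Fin)
  open import Data.Vec using (Vec; []; _∷_; lookup)
  open import Data.List using (List; []; _∷_; foldr; map; concatMap; length; filterᵇ)
  open import Data.List.Membership.Propositional using (_∈_)
  open import Data.List.Relation.Unary.Any using (here; there)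
  open import Data.List.Relation.Unary.All using () renaming (lookup to All-lookup)
  open import Data.List.Relation.Unary.AllPairs using (_∷_)
  open import Data.List.Relation.Unary.Unique.Propositional using (Unique)
  open import Data.Product using (_×_; _,_)
  open import Data.Sum using (_⊎_; inj₁; inj₂)
  open import Function using (_∘_)
  open import Relation.Binary.PropositionalEquality
  open import Relation.Nullary using (yes; no)
  open import Relation.Nullary.Decidable using (_⊎-dec_)
  open import Relation.Unary using (Pred; Decidable; _⊥_)
  open +-*-Solver

  mix : ℚ → ℚ → ℚ
  mix a b = (1ℚ - ρ) * a + ρ * b

  E : ∀ {m} → (Vec Bool m → ℚ) → ℚ
  E {zero}  f = f []
  E {suc m} f = mix (E (λ o → f (false ∷ o))) (E (λ o → f (true ∷ o)))

  expectation≡E : ∀ N (X : Orientation N → ℕ) → expectation N ρ X ≡ E (λ o → ℕtoℚ (X o))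
  expectation≡E N X = weightedSum≡E (λ o → ℕtoℚ (X o))
    where
    weightedSum : ∀ {m} → List (Vec Bool m) → (Vec Bool m → ℚ) → ℚ
    weightedSum L f = foldr _+_ 0ℚ (map (λ o → weight ρ o * f o) L)
    regroup : ∀ q r w a b A B → q * w * a + (r * w * b + (q * A + r * B)) ≡ q * (w * a + A) + r * (w * b + B)
    regroup = solve 7 (λ q r w a b A B →
      q :* w :* a :+ (r :* w :* b :+ (q :* A :+ r :* B)) := q :* (w :* a :+ A) :+ r :* (w :* b :+ B)) refl
    branch : ∀ {m} (f : Vec Bool (suc m) → ℚ) L →
             weightedSum (concatMap (λ v → (false ∷ v) ∷ (true ∷ v) ∷ []) L) f
             ≡ mix (weightedSum L (λ o → f (false ∷ o))) (weightedSum L (λ o → f (true ∷ o)))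
    branch f []      = solve 1 (λ r → con 0ℚ := (con 1ℚ :- r) :* con 0ℚ :+ r :* con 0ℚ) refl ρ
    branch f (v ∷ L) =
      trans (cong (λ s → (1ℚ - ρ) * weight ρ v * f (false ∷ v) + (ρ * weight ρ v * f (true ∷ v) + s))
                  (branch f L))
            (regroup (1ℚ - ρ) ρ (weight ρ v) _ _ _ _)
    weightedSum≡E : ∀ {m} (f : Vec Bool m → ℚ) → weightedSum (allVecs m) f ≡ E f
    weightedSum≡E {zero}  f = trans (ℚ.+-identityʳ _) (ℚ.*-identityˡ _)
    weightedSum≡E {suc m} f = trans (branch f (allVecs m))
      (cong₂ mix (weightedSum≡E (λ o → f (false ∷ o))) (weightedSum≡E (λ o → f (true ∷ o))))

  E-cong : ∀ {m} {f g : Vec Bool m → ℚ} → (∀ o → f o ≡ g o) → E f ≡ E g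
  E-cong {zero}  f≗g = f≗g []
  E-cong {suc m} f≗g = cong₂ mix (E-cong (λ o → f≗g (false ∷ o))) (E-cong (λ o → f≗g (true ∷ o)))

  E-map : ∀ {m} (h : ℚ → ℚ) → (∀ a b → mix (h a) (h b) ≡ h (mix a b)) →
          (f : Vec Bool m → ℚ) → E (λ o → h (f o)) ≡ h (E f)
  E-map {zero}  h h-mix f = refl
  E-map {suc m} h h-mix f =
    trans (cong₂ mix (E-map h h-mix (λ o → f (false ∷ o))) (E-map h h-mix (λ o → f (true ∷ o)))) (h-mix _ _)

  E-map₂ : ∀ {m} (h : ℚ → ℚ → ℚ) → (∀ a b a' b' → mix (h a a') (h b b') ≡ h (mix a b) (mix a' b')) →
           (f g : Vec Bool m → ℚ) → E (λ o → h (f o) (g o)) ≡ h (E f) (E g)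
  E-map₂ {zero}  h h-mix f g = refl
  E-map₂ {suc m} h h-mix f g =
    trans (cong₂ mix (E-map₂ h h-mix (λ o → f (false ∷ o)) (λ o → g (false ∷ o)))
                     (E-map₂ h h-mix (λ o → f (true ∷ o)) (λ o → g (true ∷ o))))
          (h-mix _ _ _ _)

  E-const : ∀ {m} c → E {m} (λ _ → c) ≡ c
  E-const {m} c = E-map {m} (λ _ → c) (λ _ _ → mix-idem) (λ _ → 0ℚ)
    where
    mix-idem : mix c c ≡ c
    mix-idem = solve 2 (λ r c → (con 1ℚ :- r) :* c :+ r :* c := c) refl ρ c

  E-1- : ∀ {m} (f : Vec Bool m → ℚ) → E (λ o → 1ℚ - f o) ≡ 1ℚ - E f
  E-1- = E-map (1ℚ -_) (solve 3 (λ r a b →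
    (con 1ℚ :- r) :* (con 1ℚ :- a) :+ r :* (con 1ℚ :- b) := con 1ℚ :- ((con 1ℚ :- r) :* a :+ r :* b)) refl ρ)

  E-+ : ∀ {m} (f g : Vec Bool m → ℚ) → E (λ o → f o + g o) ≡ E f + E g
  E-+ = E-map₂ _+_ (solve 5 (λ r a b a' b' →
    (con 1ℚ :- r) :* (a :+ a') :+ r :* (b :+ b')
      := ((con 1ℚ :- r) :* a :+ r :* b) :+ ((con 1ℚ :- r) :* a' :+ r :* b')) refl ρ)

  E-mono : ∀ {m} {f g : Vec Bool m → ℚ} → 0ℚ ≤ ρ → ρ ≤ 1ℚ → (∀ o → f o ≤ g o) → E f ≤ E g
  E-mono {zero}  _   _   f≤g = f≤g []
  E-mono {suc m} 0≤ρ ρ≤1 f≤g = ℚ.+-mono-≤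
    (ℚ.*-monoˡ-≤-nonNeg (1ℚ - ρ) {{1-ρ≥0}} (E-mono 0≤ρ ρ≤1 (λ o → f≤g (false ∷ o))))
    (ℚ.*-monoˡ-≤-nonNeg ρ {{ℚ.nonNegative 0≤ρ}} (E-mono 0≤ρ ρ≤1 (λ o → f≤g (true ∷ o))))
    where
    1-ρ≥0 : NonNegative (1ℚ - ρ)
    1-ρ≥0 = ℚ.nonNegative (subst (_≤ 1ℚ - ρ) (ℚ.+-inverseʳ ρ) (ℚ.+-monoˡ-≤ (ℚ.- ρ) ρ≤1))

  -- At each coin one of the two factors ignores the coin, so the product factorises coin by coin.
  E-* : ∀ {m} {P Q : Pred (Fin m) 0ℓ} {f g : Vec Bool m → ℚ} → Decidable P → P ⊥ Q →
        DependsOn P f → DependsOn Q g → E (λ o → f o * g o) ≡ E f * E g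
  E-* {zero}  _ _ _ _ = refl
  E-* {suc m} {P} {Q} {f} {g} P? P⊥Q f-dep g-dep = begin
    mix (E (λ o → f₀ o * g₀ o)) (E (λ o → f₁ o * g₁ o))
      ≡⟨ cong₂ mix (E-* (P? ∘ Fin.suc) P⊥Q (dependsOn-∷ false f-dep) (dependsOn-∷ false g-dep))
                   (E-* (P? ∘ Fin.suc) P⊥Q (dependsOn-∷ true f-dep) (dependsOn-∷ true g-dep)) ⟩
    mix (E f₀ * E g₀) (E f₁ * E g₁)
      ≡⟨ mix-* one-factor-constant ⟩
    mix (E f₀) (E f₁) * mix (E g₀) (E g₁)
      ∎
    where
    open ≡-Reasoning
    f₀ f₁ g₀ g₁ : Vec Bool m → ℚ
    f₀ o = f (false ∷ o)
    f₁ o = f (true ∷ o)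
    g₀ o = g (false ∷ o)
    g₁ o = g (true ∷ o)
    one-factor-constant : E f₀ ≡ E f₁ ⊎ E g₀ ≡ E g₁
    one-factor-constant with P? Fin.zero
    ... | yes 0∈P = inj₂ (E-cong (dependsOn-∉ g-dep (λ 0∈Q → P⊥Q (0∈P , 0∈Q))))
    ... | no  0∉P = inj₁ (E-cong (dependsOn-∉ f-dep 0∉P))
    mix-* : ∀ {a₀ a₁ b₀ b₁} → a₀ ≡ a₁ ⊎ b₀ ≡ b₁ →
            mix (a₀ * b₀) (a₁ * b₁) ≡ mix a₀ a₁ * mix b₀ b₁
    mix-* {a} {_} {b₀} {b₁} (inj₁ refl) = solve 4 (λ r a b₀ b₁ →
      (con 1ℚ :- r) :* (a :* b₀) :+ r :* (a :* b₁)
        := ((con 1ℚ :- r) :* a :+ r :* a) :* ((con 1ℚ :- r) :* b₀ :+ r :* b₁)) refl ρ a b₀ b₁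
    mix-* {a₀} {a₁} {b} {_} (inj₂ refl) = solve 4 (λ r a₀ a₁ b →
      (con 1ℚ :- r) :* (a₀ :* b) :+ r :* (a₁ :* b)
        := ((con 1ℚ :- r) :* a₀ :+ r :* a₁) :* ((con 1ℚ :- r) :* b :+ r :* b)) refl ρ a₀ a₁ b

  Pr : ∀ {m} → (Vec Bool m → Bool) → ℚ
  Pr e = E (λ o → χ (e o))

  Pr-not : ∀ {m} (e : Vec Bool m → Bool) → Pr (λ o → not (e o)) ≡ 1ℚ - Pr e
  Pr-not e = trans (E-cong (λ o → χ-not (e o))) (E-1- (λ o → χ (e o)))
    where
    χ-not : ∀ a → χ (not a) ≡ 1ℚ - χ a
    χ-not true  = refl
    χ-not false = refl

  module _ {m} {P Q : Pred (Fin m) 0ℓ} (P? : Decidable P) (P⊥Q : P ⊥ Q) where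

    Pr-∧ : ∀ {e e' : Vec Bool m → Bool} → DependsOn P e → DependsOn Q e' →
           Pr (λ o → e o ∧ e' o) ≡ Pr e * Pr e'
    Pr-∧ {e} {e'} e-dep e'-dep =
      trans (E-cong (λ o → χ-∧ (e o) (e' o))) (E-* P? P⊥Q (dependsOn-map χ e-dep) (dependsOn-map χ e'-dep))
      where
      χ-∧ : ∀ a b → χ (a ∧ b) ≡ χ a * χ b
      χ-∧ true  true  = refl
      χ-∧ true  false = refl
      χ-∧ false true  = refl
      χ-∧ false false = refl

    Pr-∨ : ∀ {e e' : Vec Bool m → Bool} → DependsOn P e → DependsOn Q e' →
           Pr (λ o → e o ∨ e' o) ≡ 1ℚ - (1ℚ - Pr e) * (1ℚ - Pr e')
    Pr-∨ {e} {e'} e-dep e'-dep = begin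
      Pr (λ o → e o ∨ e' o)
        ≡⟨ E-cong (λ o → χ-∨ (e o) (e' o)) ⟩
      E (λ o → 1ℚ - (1ℚ - χ (e o)) * (1ℚ - χ (e' o)))
        ≡⟨ E-1- {m} _ ⟩
      1ℚ - E (λ o → (1ℚ - χ (e o)) * (1ℚ - χ (e' o)))
        ≡⟨ cong (1ℚ -_) (E-* P? P⊥Q (dependsOn-map (λ a → 1ℚ - χ a) e-dep) (dependsOn-map (λ a → 1ℚ - χ a) e'-dep)) ⟩
      1ℚ - E (λ o → 1ℚ - χ (e o)) * E (λ o → 1ℚ - χ (e' o))
        ≡⟨ cong₂ (λ a b → 1ℚ - a * b) (E-1- {m} _) (E-1- {m} _) ⟩
      1ℚ - (1ℚ - Pr e) * (1ℚ - Pr e')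
        ∎
      where
      open ≡-Reasoning
      χ-∨ : ∀ a b → χ (a ∨ b) ≡ 1ℚ - (1ℚ - χ a) * (1ℚ - χ b)
      χ-∨ true  true  = refl
      χ-∨ true  false = refl
      χ-∨ false true  = refl
      χ-∨ false false = refl

    Pr-if : ∀ {c a b : Vec Bool m → Bool} → DependsOn P c → DependsOn Q a → DependsOn Q b →
            Pr (λ o → if c o then a o else b o) ≡ Pr c * Pr a + (1ℚ - Pr c) * Pr b
    Pr-if {c} {a} {b} c-dep a-dep b-dep = begin
      Pr (λ o → if c o then a o else b o)
        ≡⟨ E-cong (λ o → χ-if (c o) (a o) (b o)) ⟩
      E (λ o → χ (c o) * χ (a o) + (1ℚ - χ (c o)) * χ (b o))
        ≡⟨ E-+ {m} _ _ ⟩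
      E (λ o → χ (c o) * χ (a o)) + E (λ o → (1ℚ - χ (c o)) * χ (b o))
        ≡⟨ cong₂ _+_ (E-* P? P⊥Q (dependsOn-map χ c-dep) (dependsOn-map χ a-dep))
                     (E-* P? P⊥Q (dependsOn-map (λ v → 1ℚ - χ v) c-dep) (dependsOn-map χ b-dep)) ⟩
      Pr c * Pr a + E (λ o → 1ℚ - χ (c o)) * Pr b
        ≡⟨ cong (λ p → Pr c * Pr a + p * Pr b) (E-1- {m} _) ⟩
      Pr c * Pr a + (1ℚ - Pr c) * Pr b
        ∎
      where
      open ≡-Reasoning
      χ-if : ∀ c a b → χ (if c then a else b) ≡ χ c * χ a + (1ℚ - χ c) * χ b
      χ-if true  true  true  = refl
      χ-if true  true  false = refl
      χ-if true  false true  = refl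
      χ-if true  false false = refl
      χ-if false true  true  = refl
      χ-if false true  false = refl
      χ-if false false true  = refl
      χ-if false false false = refl

  Pr-lookup : ∀ {m} (i : Fin m) → Pr (λ o → lookup o i) ≡ ρ
  Pr-lookup {suc m} Fin.zero    = begin
    mix (E {m} (λ _ → 0ℚ)) (E {m} (λ _ → 1ℚ))
      ≡⟨ cong₂ mix (E-const {m} 0ℚ) (E-const {m} 1ℚ) ⟩
    mix 0ℚ 1ℚ
      ≡⟨ solve 1 (λ r → (con 1ℚ :- r) :* con 0ℚ :+ r :* con 1ℚ := r) refl ρ ⟩
    ρ ∎
    where open ≡-Reasoning
  Pr-lookup {suc m} (Fin.suc i) = begin
    mix (Pr (λ o → lookup o i)) (Pr (λ o → lookup o i))
      ≡⟨ cong₂ mix (Pr-lookup i) (Pr-lookup i) ⟩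
    mix ρ ρ
      ≡⟨ solve 1 (λ r → (con 1ℚ :- r) :* r :+ r :* r := r) refl ρ ⟩
    ρ ∎
    where open ≡-Reasoning

  pr : Bool → ℚ
  pr true  = ρ
  pr false = 1ℚ - ρ

  Pr-literal : ∀ {m} b (i : Fin m) → Pr (λ o → literal b (lookup o i)) ≡ pr b
  Pr-literal true  i = Pr-lookup i
  Pr-literal false i = trans (Pr-not (λ o → lookup o i)) (cong (1ℚ -_) (Pr-lookup i))

  Pr-somePairBoth : ∀ {m} b (ps : List (Fin m × Fin m)) → Unique (endpoints ps) →
                    Pr (somePairBoth b ps) ≡ 1ℚ - (1ℚ - pr b * pr b) ^ℚ length ps
  Pr-somePairBoth {m} b [] _ = E-const {m} 0ℚ
  Pr-somePairBoth {m} b ((j , k) ∷ ps) (j∉ ∷ k∉ ∷ ps-unique) = begin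
    Pr (λ o → both o ∨ somePairBoth b ps o)
      ≡⟨ Pr-∨ jk? jk⊥ps both-dependsOn (somePairBoth-dependsOn b ps) ⟩
    1ℚ - (1ℚ - Pr both) * (1ℚ - Pr (somePairBoth b ps))
      ≡⟨ cong₂ (λ p q → 1ℚ - (1ℚ - p) * (1ℚ - q)) Pr-both (Pr-somePairBoth b ps ps-unique) ⟩
    1ℚ - (1ℚ - pr b * pr b) * (1ℚ - (1ℚ - (1ℚ - pr b * pr b) ^ℚ length ps))
      ≡⟨ solve 2 (λ a X → con 1ℚ :- a :* (con 1ℚ :- (con 1ℚ :- X)) := con 1ℚ :- a :* X) refl
                 (1ℚ - pr b * pr b) ((1ℚ - pr b * pr b) ^ℚ length ps) ⟩
    1ℚ - (1ℚ - pr b * pr b) ^ℚ length ((j , k) ∷ ps)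
      ∎
    where
    open ≡-Reasoning
    both : Vec Bool m → Bool
    both o = literal b (lookup o j) ∧ literal b (lookup o k)
    jk? : Decidable (λ i → j ≡ i ⊎ k ≡ i)
    jk? i = (j Fin.≟ i) ⊎-dec (k Fin.≟ i)
    jk⊥ps : (λ i → j ≡ i ⊎ k ≡ i) ⊥ (_∈ endpoints ps)
    jk⊥ps (inj₁ refl , j∈ps) = All-lookup j∉ (there j∈ps) refl
    jk⊥ps (inj₂ refl , k∈ps) = All-lookup k∉ k∈ps refl
    both-dependsOn : DependsOn (λ i → j ≡ i ⊎ k ≡ i) both
    both-dependsOn o o' agree =
      cong₂ _∧_ (cong (literal b) (agree (inj₁ refl))) (cong (literal b) (agree (inj₂ refl)))
    Pr-both : Pr both ≡ pr b * pr b
    Pr-both = trans (Pr-∧ (j Fin.≟_) (λ (j≡i , k≡i) → All-lookup j∉ (here refl) (trans j≡i (sym k≡i)))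
                          (λ o o' agree → cong (literal b) (agree refl))
                          (λ o o' agree → cong (literal b) (agree refl)))
                    (cong₂ _*_ (Pr-literal b j) (Pr-literal b k))

  linkProbability : ℕ → ℚ
  linkProbability n = 1ℚ - ρ * (((ℕtoℚ 2 * ρ) - ρ * ρ) ^ℚ n) - (1ℚ - ρ) * ((1ℚ - ρ * ρ) ^ℚ n)

  Pr-linked : ∀ {m} (i : Fin m) ps → Unique (i ∷ endpoints ps) → Pr (linked i ps) ≡ linkProbability (length ps)
  Pr-linked i ps (i∉ps ∷ ps-unique) = begin
    Pr (linked i ps)
      ≡⟨ Pr-if (i Fin.≟_) (λ (i≡j , j∈ps) → All-lookup i∉ps j∈ps i≡j) (λ o o' agree → agree refl)
               (somePairBoth-dependsOn false ps) (somePairBoth-dependsOn true ps) ⟩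
    Pr (λ o → lookup o i) * Pr (somePairBoth false ps)
      + (1ℚ - Pr (λ o → lookup o i)) * Pr (somePairBoth true ps)
      ≡⟨ cong₂ (λ p q → p * q + (1ℚ - p) * Pr (somePairBoth true ps))
               (Pr-lookup i) (Pr-somePairBoth false ps ps-unique) ⟩
    ρ * (1ℚ - (1ℚ - (1ℚ - ρ) * (1ℚ - ρ)) ^ℚ n) + (1ℚ - ρ) * Pr (somePairBoth true ps)
      ≡⟨ cong₂ (λ p q → ρ * (1ℚ - p ^ℚ n) + (1ℚ - ρ) * q)
               1-[1-ρ]²≡2ρ-ρ² (Pr-somePairBoth true ps ps-unique) ⟩
    ρ * (1ℚ - (ℕtoℚ 2 * ρ - ρ * ρ) ^ℚ n) + (1ℚ - ρ) * (1ℚ - (1ℚ - ρ * ρ) ^ℚ n)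
      ≡⟨ solve 3 (λ r X Y → r :* (con 1ℚ :- X) :+ (con 1ℚ :- r) :* (con 1ℚ :- Y)
                              := con 1ℚ :- r :* X :- (con 1ℚ :- r) :* Y)
               refl ρ ((ℕtoℚ 2 * ρ - ρ * ρ) ^ℚ n) ((1ℚ - ρ * ρ) ^ℚ n) ⟩
    linkProbability n
      ∎
    where
    open ≡-Reasoning
    n : ℕ
    n = length ps
    1-[1-ρ]²≡2ρ-ρ² : 1ℚ - (1ℚ - ρ) * (1ℚ - ρ) ≡ ℕtoℚ 2 * ρ - ρ * ρ
    1-[1-ρ]²≡2ρ-ρ² =
      solve 1 (λ r → con 1ℚ :- (con 1ℚ :- r) :* (con 1ℚ :- r) := con (ℕtoℚ 2) :* r :- r :* r) refl ρ

  E-count : ∀ {m} {K : Set} (e : K → Vec Bool m → Bool) {q} → (∀ k → Pr (e k) ≡ q) → ∀ ks →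
            E (λ o → ℕtoℚ (length (filterᵇ (λ k → e k o) ks))) ≡ ℕtoℚ (length ks) * q
  E-count {m} e {q} Pr-e≡q []       = trans (E-const {m} 0ℚ) (sym (ℚ.*-zeroˡ q))
  E-count {m} {K} e {q} Pr-e≡q (k ∷ ks) = begin
    E (λ o → ℕtoℚ (length (filterᵇ (λ k → e k o) (k ∷ ks))))
      ≡⟨ E-cong (λ o → count-∷ (λ k → e k o)) ⟩
    E (λ o → χ (e k o) + ℕtoℚ (length (filterᵇ (λ k → e k o) ks)))
      ≡⟨ E-+ (λ o → χ (e k o)) _ ⟩
    Pr (e k) + E (λ o → ℕtoℚ (length (filterᵇ (λ k → e k o) ks)))
      ≡⟨ cong₂ _+_ (Pr-e≡q k) (E-count e Pr-e≡q ks) ⟩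
    q + ℕtoℚ (length ks) * q
      ≡⟨ solve 2 (λ q n → q :+ n :* q := (con 1ℚ :+ n) :* q) refl q (ℕtoℚ (length ks)) ⟩
    (1ℚ + ℕtoℚ (length ks)) * q
      ≡⟨ cong (_* q) (ℕtoℚ-suc (length ks)) ⟨
    ℕtoℚ (length (k ∷ ks)) * q
      ∎
    where
    open ≡-Reasoning
    count-∷ : ∀ (p : K → Bool) →
              ℕtoℚ (length (filterᵇ p (k ∷ ks))) ≡ χ (p k) + ℕtoℚ (length (filterᵇ p ks))
    count-∷ p with p k
    ... | true  = ℕtoℚ-suc (length (filterᵇ p ks))
    ... | false = sym (ℚ.+-identityˡ _)

module DivisorGraph (N : ℕ) where

  open Counting
  open Primes using (NontrivialDivisorOf)
  open Coins using (linked; somePairBoth; endpoints)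
  open Bernoulli using (Pr; Pr-linked; linkProbability)
  open import Data.Nat using (suc; _≤_; _<_; s≤s)
  open import Data.Nat.Properties using (≤-refl; ≤-trans; <⇒≤; <-irrefl; _≤?_)
  open import Data.Nat.Divisibility using (_∣_; _∣?_; 1∣_)
  open import Data.Bool using (Bool; true; false; T)
  open import Data.Fin using (Fin)
  open import Data.List as List using (List; []; _∷_; length; map; upTo)
  open import Data.List.Membership.Propositional using (_∈_; find)
  open import Data.List.Membership.Propositional.Properties
    using (∈-map⁺; ∈-map⁻; ∈-filter⁺; ∈-filter⁻; ∈-upTo⁺; ∈-upTo⁻; ∈-concatMap⁺; ∈-concatMap⁻;
           ∈-lookup)
  open import Data.List.Relation.Unary.Any as Any using (here; there)
  open import Data.List.Relation.Unary.Any.Properties using (lookup-index)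
  open import Data.List.Relation.Unary.All as All using (All; []; _∷_)
  open import Data.List.Relation.Unary.AllPairs using ([]; _∷_)
  open import Data.List.Relation.Unary.Unique.Propositional using (Unique)
  import Data.List.Relation.Unary.Unique.Propositional.Properties as Unique
  open import Data.Vec as Vec using (Vec)
  open import Data.Product using (∃; _×_; _,_; proj₁; proj₂)
  open import Data.Sum using (_⊎_; inj₁; inj₂)
  open import Function using (_∘_)
  open import Relation.Binary.PropositionalEquality
  open import Relation.Binary.Construct.Closure.ReflexiveTransitive using (ε; _◅_)
  open import Relation.Nullary using (¬¬-map)
  open import Relation.Nullary.Decidable using (decidable-stable)

  edge∈ : ∀ {a b} → 1 ≤ b → b < a → a ≤ N → b ∣ a → (a , b) ∈ edges N
  edge∈ {suc a} {suc b} _ (s≤s b<a) a<N b∣a =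
    ∈-concatMap⁺ edgesAt (Any.map (λ { refl → at-a }) (∈-map⁺ suc (∈-upTo⁺ a<N)))
    where
    at-a : (suc a , suc b) ∈ edgesAt (suc a)
    at-a = ∈-map⁺ (suc a ,_)
             (∈-filter⁺ (_∣? suc a) {xs = map suc (upTo a)} (∈-map⁺ suc (∈-upTo⁺ b<a)) b∣a)

  edge-endpoints≤N : ∀ {e} → e ∈ edges N → proj₁ e ≤ N × proj₂ e ≤ N
  edge-endpoints≤N e∈ with find (∈-concatMap⁻ edgesAt {xs = map suc (upTo N)} e∈)
  ... | a , a∈ , e∈edgesAt-a with ∈-map⁻ suc a∈ | ∈-map⁻ (a ,_) e∈edgesAt-a
  ... | a' , a'<N , refl | b , b∈ , refl
    with ∈-map⁻ suc (proj₁ (∈-filter⁻ (_∣? suc a') {xs = map suc (upTo a')} b∈))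
  ... | b' , b'<a' , refl = ∈-upTo⁻ a'<N , ≤-trans (∈-upTo⁻ b'<a') (<⇒≤ (∈-upTo⁻ a'<N))

  arc-source≤N : ∀ {o u v} → Arc N o u v → u ≤ N
  arc-source≤N (i , inj₁ (_ , refl , _)) = proj₁ (edge-endpoints≤N (∈-lookup i))
  arc-source≤N (i , inj₂ (_ , refl , _)) = proj₂ (edge-endpoints≤N (∈-lookup i))

  sameSCC-1⇒≤N : ∀ {o u} → 1 ≤ N → SameSCC N o u 1 → u ≤ N
  sameSCC-1⇒≤N 1≤N (ε , _)       = 1≤N
  sameSCC-1⇒≤N {o} 1≤N (arc ◅ _ , _) = arc-source≤N {o} arc

  Unique-⊆SCC⇒length≤ : ∀ {o s} → 1 ≤ N → IsLargestSCCSize N o s →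
                         ∀ ys → Unique ys → (∀ {y} → y ∈ ys → SameSCC N o y 1) → length ys ≤ s
  Unique-⊆SCC⇒length≤ {o} {s} 1≤N (_ , largest) ys ys-unique ys⊆scc =
    decidable-stable (length ys ≤? s)
      (¬¬-map bound (¬¬-enumerate {λ u → SameSCC N o u 1} (suc N) (s≤s ∘ sameSCC-1⇒≤N {o} 1≤N)))
    where
    bound : ∃ (EnumeratesSCC N o 1) → length ys ≤ s
    bound (xs , enum@(_ , _ , complete)) =
      ≤-trans (Unique-⊆⇒length≤ ys ys-unique (λ y∈ys → complete _ (ys⊆scc y∈ys)))
              (largest 1 ≤-refl 1≤N xs enum)

  index : ∀ {e} → e ∈ edges N → Fin (numEdges N)
  index = Any.index

  forwardArc : ∀ {o u v} (uv∈ : (u , v) ∈ edges N) → Vec.lookup o (index uv∈) ≡ false → Arc N o u v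
  forwardArc uv∈ forward =
    index uv∈ , inj₁ (forward , cong proj₁ (lookup-index uv∈) , cong proj₂ (lookup-index uv∈))

  reversedArc : ∀ {o u v} (uv∈ : (u , v) ∈ edges N) → Vec.lookup o (index uv∈) ≡ true → Arc N o v u
  reversedArc uv∈ reversed =
    index uv∈ , inj₂ (reversed , cong proj₂ (lookup-index uv∈) , cong proj₁ (lookup-index uv∈))

  module Link {a} (1<a : 1 < a) (a≤N : a ≤ N) where

    a1∈ : (a , 1) ∈ edges N
    a1∈ = edge∈ ≤-refl 1<a a≤N (1∣ a)

    ab∈ : ∀ {b} → NontrivialDivisorOf a b → (a , b) ∈ edges N
    ab∈ (1<b , b<a , b∣a) = edge∈ (<⇒≤ 1<b) b<a a≤N b∣a

    b1∈ : ∀ {b} → NontrivialDivisorOf a b → (b , 1) ∈ edges N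
    b1∈ (1<b , b<a , _) = edge∈ ≤-refl 1<b (≤-trans (<⇒≤ b<a) a≤N) (1∣ _)

    detours : ∀ {bs} → All (NontrivialDivisorOf a) bs → List (Fin (numEdges N) × Fin (numEdges N))
    detours = All.reduce (λ b∣a → index (ab∈ b∣a) , index (b1∈ b∣a))

    link : ∀ {bs} → All (NontrivialDivisorOf a) bs → Orientation N → Bool
    link ds = linked (index a1∈) (detours ds)

    forwardDetour : ∀ {bs o} (ds : All (NontrivialDivisorOf a) bs) →
                    T (somePairBoth false (detours ds) o) → Reach N o a 1
    forwardDetour {o = o} (d ∷ ds) t
      with Vec.lookup o (index (ab∈ d)) in ab-forward | Vec.lookup o (index (b1∈ d)) in b1-forward
    ... | false | false = forwardArc {o} (ab∈ d) ab-forward ◅ forwardArc {o} (b1∈ d) b1-forward ◅ ε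
    ... | false | true  = forwardDetour {o = o} ds t
    ... | true  | _     = forwardDetour {o = o} ds t

    reversedDetour : ∀ {bs o} (ds : All (NontrivialDivisorOf a) bs) →
                     T (somePairBoth true (detours ds) o) → Reach N o 1 a
    reversedDetour {o = o} (d ∷ ds) t
      with Vec.lookup o (index (ab∈ d)) in ab-reversed | Vec.lookup o (index (b1∈ d)) in b1-reversed
    ... | true  | true  = reversedArc {o} (b1∈ d) b1-reversed ◅ reversedArc {o} (ab∈ d) ab-reversed ◅ ε
    ... | true  | false = reversedDetour {o = o} ds t
    ... | false | _     = reversedDetour {o = o} ds t

    link-sound : ∀ {bs} (ds : All (NontrivialDivisorOf a) bs) o → T (link ds o) → SameSCC N o a 1
    link-sound ds o t with Vec.lookup o (index a1∈) in a1-direction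
    ... | true  = forwardDetour {o = o} ds t , reversedArc {o} a1∈ a1-direction ◅ ε
    ... | false = forwardArc {o} a1∈ a1-direction ◅ ε , reversedDetour {o = o} ds t

    detour : ℕ → (ℕ × ℕ) × (ℕ × ℕ)
    detour b = (a , b) , (b , 1)

    ∈-endpoints-detours⁻ : ∀ {e bs} → e ∈ endpoints (map detour bs) →
                           ∃ λ b → b ∈ bs × (e ≡ (a , b) ⊎ e ≡ (b , 1))
    ∈-endpoints-detours⁻ {bs = b ∷ _} (here refl)         = b , here refl , inj₁ refl
    ∈-endpoints-detours⁻ {bs = b ∷ _} (there (here refl)) = b , here refl , inj₂ refl
    ∈-endpoints-detours⁻ {bs = _ ∷ _} (there (there e∈)) with ∈-endpoints-detours⁻ e∈
    ... | b , b∈ , shape = b , there b∈ , shape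

    -- The edges (a , 1), (a , b) and (b , 1) are told apart by 1 < b < a.
    detourEdges-unique : ∀ {bs} → Unique bs → All (NontrivialDivisorOf a) bs →
                         Unique ((a , 1) ∷ endpoints (map detour bs))
    detourEdges-unique {bs} bs-unique ds = All.tabulate a1∉ ∷ detours-unique bs-unique ds
      where
      a1∉ : ∀ {e} → e ∈ endpoints (map detour bs) → (a , 1) ≢ e
      a1∉ e∈ eq with ∈-endpoints-detours⁻ e∈
      ... | b , b∈ , inj₁ refl = <-irrefl (cong proj₂ eq) (proj₁ (All.lookup ds b∈))
      ... | b , b∈ , inj₂ refl = <-irrefl (sym (cong proj₁ eq)) (proj₁ (proj₂ (All.lookup ds b∈)))
      detours-unique : ∀ {bs} → Unique bs → All (NontrivialDivisorOf a) bs → Unique (endpoints (map detour bs))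
      detours-unique []                    []                       = []
      detours-unique {b ∷ bs} (b∉bs ∷ bs-unique) ((1<b , _) ∷ ds) =
        ((λ eq → <-irrefl (sym (cong proj₂ eq)) 1<b) ∷ All.tabulate ab∉) ∷
        All.tabulate b1∉ ∷
        detours-unique bs-unique ds
        where
        ab∉ : ∀ {e} → e ∈ endpoints (map detour bs) → (a , b) ≢ e
        ab∉ e∈ eq with ∈-endpoints-detours⁻ e∈
        ... | b' , b'∈ , inj₁ refl = All.lookup b∉bs b'∈ (cong proj₂ eq)
        ... | b' , b'∈ , inj₂ refl = <-irrefl (sym (cong proj₂ eq)) 1<b
        b1∉ : ∀ {e} → e ∈ endpoints (map detour bs) → (b , 1) ≢ e
        b1∉ e∈ eq with ∈-endpoints-detours⁻ e∈
        ... | b' , b'∈ , inj₁ refl = <-irrefl (cong proj₂ eq) (proj₁ (All.lookup ds b'∈))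
        ... | b' , b'∈ , inj₂ refl = All.lookup b∉bs b'∈ (cong proj₁ eq)

    link-indices-unique : ∀ {bs} → Unique bs → (ds : All (NontrivialDivisorOf a) bs) →
                          Unique (index a1∈ ∷ endpoints (detours ds))
    link-indices-unique bs-unique ds =
      Unique.map⁻ (subst Unique (sym (cong₂ _∷_ (sym (lookup-index a1∈)) (lookup-detours ds)))
                                (detourEdges-unique bs-unique ds))
      where
      lookup-detours : ∀ {bs} (ds : All (NontrivialDivisorOf a) bs) →
                       map (List.lookup (edges N)) (endpoints (detours ds)) ≡ endpoints (map detour bs)
      lookup-detours []       = refl
      lookup-detours (d ∷ ds) = cong₂ _∷_ (sym (lookup-index (ab∈ d)))
                                  (cong₂ _∷_ (sym (lookup-index (b1∈ d))) (lookup-detours ds))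

    Pr-link : ∀ ρ {bs} → Unique bs → (ds : All (NontrivialDivisorOf a) bs) →
              Pr ρ (link ds) ≡ linkProbability ρ (length bs)
    Pr-link ρ bs-unique ds =
      trans (Pr-linked ρ (index a1∈) (detours ds) (link-indices-unique bs-unique ds))
            (cong (linkProbability ρ) (length-detours ds))
      where
      length-detours : ∀ {bs} (ds : All (NontrivialDivisorOf a) bs) → length (detours ds) ≡ length bs
      length-detours []       = refl
      length-detours (_ ∷ ds) = cong suc (length-detours ds)

module Multiples (N x : ℕ) where

  open Primes using (NontrivialDivisorOf; primorial-nontrivialDivisors; primorial-dOf≥2)
  open DivisorGraph N using (module Link; Unique-⊆SCC⇒length≤)
  open Bernoulli using (Pr; linkProbability)
  open import Data.Nat using (suc; _≤_; _<_; _*_; NonZero)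
  open import Data.Nat.Properties using (≤-trans; <-≤-trans; m≤m+n; *-monoˡ-≤; *-cancelʳ-≡; suc-injective)
  open import Data.Nat.DivMod using (m/n*n≤m)
  open import Data.Nat.Divisibility using (∣-trans; n∣m*n)
  open import Data.Bool using (Bool; T?)
  open import Data.Fin using (Fin; toℕ)
  open import Data.Fin.Properties using (toℕ<n; toℕ-injective)
  open import Data.List using (List; length; map; filterᵇ; allFin)
  open import Data.List.Properties using (length-map)
  open import Data.List.Membership.Propositional using (_∈_)
  open import Data.List.Membership.Propositional.Properties using (∈-map⁻; ∈-filter⁻)
  open import Data.List.Relation.Unary.All as All using (All)
  open import Data.List.Relation.Unary.Unique.Propositional using (Unique)
  import Data.List.Relation.Unary.Unique.Propositional.Properties as Unique
  open import Data.Product using (_,_; proj₁; proj₂)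
  open import Relation.Binary.PropositionalEquality using (_≡_; refl; subst)
  open import Function using (_∘_)

  P : ℕ
  P = primorial (dOf x)

  instance
    P-nonZero : NonZero P
    P-nonZero = primorial-nonZero (dOf x)

  M : ℕ
  M = floorDivPrimorial N (dOf x)

  vertex : Fin M → ℕ
  vertex k = suc (toℕ k) * P

  vertex-injective : ∀ {k k'} → vertex k ≡ vertex k' → k ≡ k'
  vertex-injective eq = toℕ-injective (suc-injective (*-cancelʳ-≡ _ _ P eq))

  P≤vertex : ∀ k → P ≤ vertex k
  P≤vertex k = m≤m+n P (toℕ k * P)

  1<vertex : ∀ k → 1 < vertex k
  1<vertex k = ≤-trans (primorial-dOf≥2 x) (P≤vertex k)

  vertex≤N : ∀ k → vertex k ≤ N
  vertex≤N k = ≤-trans (*-monoˡ-≤ P (toℕ<n k)) (m/n*n≤m N P)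

  bs : List ℕ
  bs = proj₁ (primorial-nontrivialDivisors x)

  length-bs : length bs ≡ x
  length-bs = proj₁ (proj₂ (primorial-nontrivialDivisors x))

  bs-unique : Unique bs
  bs-unique = proj₁ (proj₂ (proj₂ (primorial-nontrivialDivisors x)))

  bs-divisors : All (NontrivialDivisorOf P) bs
  bs-divisors = proj₂ (proj₂ (proj₂ (primorial-nontrivialDivisors x)))

  vertex-divisors : ∀ k → All (NontrivialDivisorOf (vertex k)) bs
  vertex-divisors k = All.map
    (λ (1<b , b<P , b∣P) → 1<b , <-≤-trans b<P (P≤vertex k) , ∣-trans b∣P (n∣m*n (suc (toℕ k))))
    bs-divisors

  link : Fin M → Orientation N → Bool
  link k = Link.link (1<vertex k) (vertex≤N k) (vertex-divisors k)

  Pr-link : ∀ ρ k → Pr ρ (link k) ≡ linkProbability ρ x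
  Pr-link ρ k = subst (λ n → Pr ρ (link k) ≡ linkProbability ρ n) length-bs
                  (Link.Pr-link (1<vertex k) (vertex≤N k) ρ bs-unique (vertex-divisors k))

  #linked≤largestSCC : ∀ {o s} → 1 ≤ N → IsLargestSCCSize N o s →
                       length (filterᵇ (λ k → link k o) (allFin M)) ≤ s
  #linked≤largestSCC {o} {s} 1≤N largest =
    subst (_≤ s) (length-map vertex linkedToOne)
      (Unique-⊆SCC⇒length≤ {o} 1≤N largest (map vertex linkedToOne)
        (Unique.map⁺ vertex-injective (Unique.filter⁺ (T? ∘ λ k → link k o) (Unique.allFin⁺ M))) inSCC)
    where
    linkedToOne : List (Fin M)
    linkedToOne = filterᵇ (λ k → link k o) (allFin M)
    inSCC : ∀ {v} → v ∈ map vertex linkedToOne → SameSCC N o v 1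
    inSCC v∈ with ∈-map⁻ vertex v∈
    ... | k , k∈ , refl = Link.link-sound (1<vertex k) (vertex≤N k) (vertex-divisors k) o
                            (proj₂ (∈-filter⁻ (T? ∘ λ k → link k o) {xs = allFin M} k∈))

open import Data.Nat using (ℕ; _≤_)
open import Data.Rational using (ℚ; 0ℚ; 1ℚ; _<_; _-_; _*_)

corollary5 : (N : ℕ) → 1 ≤ N → (ρ : ℚ) → 0ℚ < ρ → ρ < 1ℚ → (x : ℕ)
    → (Φ : Orientation N → ℕ) → (∀ o → IsLargestSCCSize N o (Φ o))
    → ℕtoℚ (floorDivPrimorial N (dOf x))
        * (1ℚ - ρ * (((ℕtoℚ 2 * ρ) - ρ * ρ) ^ℚ x) - (1ℚ - ρ) * ((1ℚ - ρ * ρ) ^ℚ x))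
      Data.Rational.≤ expectation N ρ Φ
corollary5 N 1≤N ρ 0<ρ ρ<1 x Φ Φ-largest = begin
  ℕtoℚ M * linkProbability ρ x
    ≡⟨ cong (λ n → ℕtoℚ n * linkProbability ρ x) (length-tabulate (id {A = Fin M})) ⟨
  ℕtoℚ (length (allFin M)) * linkProbability ρ x
    ≡⟨ E-count ρ link (Pr-link ρ) (allFin M) ⟨
  E ρ (λ o → ℕtoℚ (length (filterᵇ (λ k → link k o) (allFin M))))
    ≤⟨ E-mono ρ (<⇒≤ 0<ρ) (<⇒≤ ρ<1) (λ o → ℕtoℚ-mono-≤ (#linked≤largestSCC {o} 1≤N (Φ-largest o))) ⟩
  E ρ (λ o → ℕtoℚ (Φ o))
    ≡⟨ expectation≡E ρ N Φ ⟨
  expectation N ρ Φ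
    ∎
  where
  open Multiples N x
  open Bernoulli using (E; E-count; E-mono; expectation≡E; linkProbability)
  open NatToRational using (ℕtoℚ-mono-≤)
  open import Data.Rational.Properties using (<⇒≤; module ≤-Reasoning)
  open import Data.List using (length; allFin; filterᵇ)
  open import Data.List.Properties using (length-tabulate)
  open import Function using (id)
  open import Data.Fin using (Fin)
  open import Relation.Binary.PropositionalEquality using (cong)
  open ≤-Reasoning
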